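{- Let $F$ and $g$ be positive integers, let $S \in \mathcal{E}(F,g)$ and $Q \in [S]$. Then $P$ is a child of $Q$ in $\mathcal{G}([S])$ if and only if $P = (Q \setminus \{x\}) \cup \{F - x\}$, where $x$ is a minimal generator of $Q$ satisfying: (1) $\frac{F}{2} < x < F$; (2) $F - x < \mathrm{m}(Q)$; (3) $2F \neq 3x$; (4) $2(F-x)$ is a minimal generator of $Q$; (5) $F - x \in \mathrm{PF}(Q \setminus \{x\})$.
   Context: A numerical semigroup is a subset $S \subseteq \mathbb{N}$ (with $\mathbb{N}$ the nonnegative integers) closed under addition, containing $0$, with $\mathbb{N}\setminus S$ finite. The genus of $S$ is $\#(\mathbb{N}\setminus S)$; the Frobenius number $\mathrm{F}(S)$ is the largest integer not in $S$; the multiplicity $\mathrm{m}(S)$ is the least positive integer in $S$. $S$ is elementary if $\mathrm{F}(S) < 2\,\mathrm{m}(S)$. $\mathcal{S}(F,g)$ (resp. $\mathcal{E}(F,g)$) denotes the set of (resp. elementary) numerical semigroups with Frobenius number $F$ and genus $g$. For $S \in \mathcal{S}(F,g)$ let $\theta(S) = \left(S \setminus \{x \in S\setminus\{0\} : x < \frac{F}{2}\}\right) \cup \{F - x : x \in S\setminus\{0\},\ x < \frac{F}{2}\}$ and $[S] = \{S' \in \mathcal{S}(F,g) : \theta(S') = \theta(S)\}$. The directed graph $\mathcal{G}([S])$ has vertex set $[S]$, and $(P,Q)$ is an edge iff $F > 2\,\mathrm{m}(P)$ and $Q = (P \setminus \{\mathrm{m}(P)\}) \cup \{F - \mathrm{m}(P)\}$;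 in that case $P$ is called a child of $Q$. The minimal generators of a numerical semigroup $T$ are the elements of $T\setminus\{0\}$ that cannot be written as a sum of two elements of $T\setminus\{0\}$. For a subset $T \subseteq \mathbb{N}$ containing $0$, $\mathrm{PF}(T) = \{p \in \mathbb{Z}\setminus T : p + s \in T \text{ for all } s \in T\setminus\{0\}\}$ (pseudo-Frobenius numbers). -}

module Defs where

open import Data.Bool using (Bool; true; false; _∧_; _∨_; not; if_then_else_)
open import Data.Nat using (ℕ; zero; suc; _+_; _*_; _∸_; _≤_; _<_; _≡ᵇ_; _<ᵇ_; _≤ᵇ_)
open import Data.Product using (Σ; ∃; ∃-syntax; _×_; _,_)
open import Relation.Nullary using (¬_)
open import Relation.Binary.PropositionalEquality using (_≡_; _≢_)

Subset : Set
Subset = ℕ → Bool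

infix 4 _∈_ _∉_ _≐_
_∈_ : ℕ → Subset → Set
n ∈ S = S n ≡ true

_∉_ : ℕ → Subset → Set
n ∉ S = S n ≡ false

_≐_ : Subset → Subset → Set
A ≐ B = ∀ n → A n ≡ B n

swapElem : Subset → ℕ → ℕ → Subset
swapElem T x y n = (T n ∧ not (n ≡ᵇ x)) ∨ (n ≡ᵇ y)

countGaps : Subset → ℕ → ℕ
countGaps S zero = 0
countGaps S (suc n) = (if S n then 0 else 1) + countGaps S n

record IsNumericalSemigroup (S : Subset) : Set where
  field
    has-zero  : 0 ∈ S
    closed    : ∀ a b → a ∈ S → b ∈ S → (a + b) ∈ S
    cofinite  : ∃[ N ] (∀ n → N ≤ n → n ∈ S)

IsFrobenius : Subset → ℕ → Set
IsFrobenius S F = F ∉ S × (∀ n → F < n → n ∈ S)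

IsGenus : Subset → ℕ → Set
IsGenus S g = ∃[ N ] ((∀ n → N ≤ n → n ∈ S) × countGaps S N ≡ g)

IsMultiplicity : Subset → ℕ → Set
IsMultiplicity S m = 0 < m × m ∈ S × (∀ k → 0 < k → k < m → k ∉ S)

InSFg : ℕ → ℕ → Subset → Set
InSFg F g S = IsNumericalSemigroup S × IsFrobenius S F × IsGenus S g

InEFg : ℕ → ℕ → Subset → Set
InEFg F g S = InSFg F g S × (∀ m → IsMultiplicity S m → F < 2 * m)

isSmall : ℕ → ℕ → Bool
isSmall F x = (0 <ᵇ x) ∧ ((2 * x) <ᵇ F)

-- θ(S) = (S ∖ {x ∈ S∖{0} : x < F/2}) ∪ {F - x : x ∈ S∖{0}, x < F/2}
θ : ℕ → Subset → Subset
θ F S n = (S n ∧ not (isSmall F n)) ∨ ((n ≤ᵇ F) ∧ (isSmall F (F ∸ n) ∧ S (F ∸ n)))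

InClass : ℕ → ℕ → Subset → Subset → Set
InClass F g S Q = InSFg F g Q × (θ F Q ≐ θ F S)

IsChild : ℕ → ℕ → Subset → Subset → Subset → Set
IsChild F g S P Q =
  InClass F g S P × InClass F g S Q ×
  (∃[ m ] (IsMultiplicity P m × 2 * m < F × (Q ≐ swapElem P m (F ∸ m))))

IsMinimalGenerator : Subset → ℕ → Set
IsMinimalGenerator T x =
  x ∈ T × 0 < x ×
  ¬ (∃[ a ] ∃[ b ] (a ∈ T × b ∈ T × 0 < a × 0 < b × a + b ≡ x))

IsPseudoFrobenius : Subset → ℕ → Set
IsPseudoFrobenius T p = p ∉ T × (∀ s → s ∈ T → 0 < s → (p + s) ∈ T)

remove : Subset → ℕ → Subset
remove T x n = T n ∧ not (n ≡ᵇ x)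

-- A child P of Q has multiplicity m with 2m < F, and Q = P ∖ {m} ∪ {F − m}.
-- Then x := F − m is a minimal generator of Q: any decomposition of x in Q
-- would lie in P, and adding m to it would put F in P.  Conditions (2)–(5)
-- all come from m being the least positive element of P and F ∉ P.
-- Conversely, (4) and (5), together with (3) which makes 2(F − x) ≠ x, are
-- exactly what makes Q ∖ {x} ∪ {F − x} closed under addition, and (2) makes
-- F − x its multiplicity.  Trading an element x > F/2 for F − x < F/2 keeps
-- the Frobenius number and the number of gaps, and θ is blind to it since θ
-- replaces each small element by its complement.

module Submission where

open import Defs
open import Data.Nat using (ℕ; _+_; _*_; _∸_; _<_)
open import Data.Product using (_×_; ∃-syntax)
open import Function.Bundles using (_⇔_)
open import Relation.Binary.PropositionalEquality using (_≢_)

open import Data.Bool using (true; false; _∨_; if_then_else_)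
open import Data.Bool.Properties using (T-≡; ∨-zeroʳ; ∨-identityʳ; ∧-zeroʳ; ∧-identityʳ)
open import Data.Nat using (zero; suc; _≤_; _≡ᵇ_; _<ᵇ_; _≤ᵇ_; z<s; _≟_)
open import Data.Nat.Induction using (<-rec)
open import Data.Nat.Properties
open import Data.Nat.Tactic.RingSolver using (solve-∀)
open import Algebra.Properties.CommutativeSemigroup +-commutativeSemigroup
  using (interchange; x∙yz≈y∙xz)
open import Data.Product using (_,_; proj₁; proj₂)
open import Function.Base using (_∘_)
open import Function.Bundles using (Equivalence; mk⇔)
open import Relation.Nullary using (¬_; yes; no; contradiction)
open import Relation.Binary.PropositionalEquality
  using (_≡_; refl; sym; trans; cong; cong₂; subst; subst₂; module ≡-Reasoning)

≡ᵇ-refl : ∀ n → (n ≡ᵇ n) ≡ true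
≡ᵇ-refl n = Equivalence.to T-≡ (≡⇒≡ᵇ n n refl)

≢⇒≡ᵇ≡false : ∀ {m n} → m ≢ n → (m ≡ᵇ n) ≡ false
≢⇒≡ᵇ≡false {m} {n} m≢n with m ≡ᵇ n in eq
... | true  = contradiction (≡ᵇ⇒≡ m n (Equivalence.from T-≡ eq)) m≢n
... | false = refl

2*n≡n+n : ∀ n → 2 * n ≡ n + n
2*n≡n+n n = cong (n +_) (+-identityʳ n)

m∸n≡o⇒n≡m∸o : ∀ {m n o} → 0 < o → m ∸ n ≡ o → n ≡ m ∸ o
m∸n≡o⇒n≡m∸o {m} {n} {o} 0<o m∸n≡o = begin
  n             ≡⟨ m∸[m∸n]≡n n≤m ⟨
  m ∸ (m ∸ n)   ≡⟨ cong (m ∸_) m∸n≡o ⟩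
  m ∸ o         ∎
  where
  open ≡-Reasoning
  n≤m : n ≤ m
  n≤m = <⇒≤ (m∸n≢0⇒n<m (λ m∸n≡0 → <⇒≢ 0<o (trans (sym m∸n≡0) m∸n≡o)))

double≡⇔2*sum≡3* : ∀ {y x s} → y + x ≡ s → (y + y ≡ x) ⇔ (2 * s ≡ 3 * x)
double≡⇔2*sum≡3* {y} {x} refl = mk⇔
  (λ y+y≡x → trans (two y x) (trans (cong (_+ (x + x)) y+y≡x) (sym (three x))))
  (λ 2s≡3x → +-cancelʳ-≡ (x + x) (y + y) x (trans (sym (two y x)) (trans 2s≡3x (three x))))
  where
  two : ∀ y x → 2 * (y + x) ≡ (y + y) + (x + x)
  two = solve-∀
  three : ∀ x → 3 * x ≡ x + (x + x)
  three = solve-∀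

∉⇒¬∈ : ∀ A {n} → n ∉ A → ¬ n ∈ A
∉⇒¬∈ A n∉A n∈A with trans (sym n∈A) n∉A
... | ()

remove-self : ∀ A x → x ∉ remove A x
remove-self A x rewrite ≡ᵇ-refl x = ∧-zeroʳ (A x)

remove-other : ∀ A {x n} → n ≢ x → remove A x n ≡ A n
remove-other A {n = n} n≢x rewrite ≢⇒≡ᵇ≡false n≢x = ∧-identityʳ (A n)

∈-remove⁺ : ∀ A {x n} → n ∈ A → n ≢ x → n ∈ remove A x
∈-remove⁺ A n∈A n≢x = trans (remove-other A n≢x) n∈A

∈-remove⁻ : ∀ A x {n} → n ∈ remove A x → n ∈ A × n ≢ x
∈-remove⁻ A x {n} n∈ = trans (sym (remove-other A n≢x)) n∈ , n≢x
  where
  n≢x : n ≢ x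
  n≢x refl = ∉⇒¬∈ (remove A x) (remove-self A x) n∈

swapElem-new : ∀ A x y → y ∈ swapElem A x y
swapElem-new A x y rewrite ≡ᵇ-refl y = ∨-zeroʳ (remove A x y)

swapElem-old : ∀ A {x y} → x ≢ y → x ∉ swapElem A x y
swapElem-old A {x} x≢y rewrite ≡ᵇ-refl x | ≢⇒≡ᵇ≡false x≢y =
  trans (∨-identityʳ _) (∧-zeroʳ (A x))

swapElem-other : ∀ A {x y n} → n ≢ x → n ≢ y → swapElem A x y n ≡ A n
swapElem-other A {n = n} n≢x n≢y rewrite ≢⇒≡ᵇ≡false n≢x | ≢⇒≡ᵇ≡false n≢y =
  trans (∨-identityʳ _) (∧-identityʳ (A n))

isSmall-true : ∀ {F n} → 0 < n → 2 * n < F → isSmall F n ≡ true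
isSmall-true 0<n 2n<F
  rewrite Equivalence.to T-≡ (<⇒<ᵇ 0<n) | Equivalence.to T-≡ (<⇒<ᵇ 2n<F) = refl

isSmall-false : ∀ {F n} → F ≤ 2 * n → isSmall F n ≡ false
isSmall-false {F} {n} F≤2n with 2 * n <ᵇ F in eq
... | true  = contradiction (<ᵇ⇒< (2 * n) F (Equivalence.from T-≡ eq)) (≤⇒≯ F≤2n)
... | false = ∧-zeroʳ (0 <ᵇ n)

occurrencesBelow : ℕ → ℕ → ℕ
occurrencesBelow y zero    = 0
occurrencesBelow y (suc n) = (if n ≡ᵇ y then 1 else 0) + occurrencesBelow y n

occurrencesBelow-≤ : ∀ {y N} → N ≤ y → occurrencesBelow y N ≡ 0
occurrencesBelow-≤ {N = zero}  _    = refl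
occurrencesBelow-≤ {N = suc N} N<y
  rewrite ≢⇒≡ᵇ≡false (<⇒≢ N<y) = occurrencesBelow-≤ (<⇒≤ N<y)

occurrencesBelow-> : ∀ {y N} → y < N → occurrencesBelow y N ≡ 1
occurrencesBelow-> {y} {suc N} y<1+N with N ≟ y
... | yes refl rewrite ≡ᵇ-refl N = cong suc (occurrencesBelow-≤ {N} ≤-refl)
... | no N≢y rewrite ≢⇒≡ᵇ≡false N≢y =
  occurrencesBelow-> (≤∧≢⇒< (≤-pred y<1+N) (N≢y ∘ sym))

∉-below-multiplicity : ∀ A {b} → (∀ m → IsMultiplicity A m → b < m) →
                       ∀ k → 0 < k → k ≤ b → k ∉ A
∉-below-multiplicity A {b} b<multiplicity = <-rec (λ k → 0 < k → k ≤ b → k ∉ A) step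
  where
  step : ∀ k → (∀ {j} → j < k → 0 < j → j ≤ b → j ∉ A) → 0 < k → k ≤ b → k ∉ A
  step k below 0<k k≤b with A k in k∈A
  ... | false = refl
  ... | true  = contradiction
    (b<multiplicity k (0<k , k∈A , λ j 0<j j<k → below j<k 0<j (≤-trans (<⇒≤ j<k) k≤b)))
    (≤⇒≯ k≤b)

module SwapElem {A B : Subset} {x y : ℕ} (B≐ : B ≐ swapElem A x y) (x≢y : x ≢ y) where

  swapped-in : y ∈ B
  swapped-in = trans (B≐ y) (swapElem-new A x y)

  swapped-out : x ∉ B
  swapped-out = trans (B≐ x) (swapElem-old A x≢y)

  unchanged : ∀ {n} → n ≢ x → n ≢ y → B n ≡ A n
  unchanged {n} n≢x n≢y = trans (B≐ n) (swapElem-other A n≢x n≢y)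

  remove⊆ : ∀ {n} → n ∈ remove A x → n ∈ B
  remove⊆ {n} n∈ = trans (B≐ n) (cong (_∨ (n ≡ᵇ y)) n∈)

  ⊆remove : ∀ {n} → n ∈ B → n ≢ y → n ∈ remove A x
  ⊆remove {n} n∈B n≢y = begin
    remove A x n                ≡⟨ ∨-identityʳ _ ⟨
    remove A x n ∨ false        ≡⟨ cong (remove A x n ∨_) (≢⇒≡ᵇ≡false n≢y) ⟨
    swapElem A x y n            ≡⟨ B≐ n ⟨
    B n                         ≡⟨ n∈B ⟩
    true                        ∎
    where open ≡-Reasoning

  inverse : x ∈ A → y ∉ A → A ≐ swapElem B y x
  inverse x∈A y∉A n with n ≟ x | n ≟ y
  ... | yes refl | _        = trans x∈A (sym (swapElem-new B y x))
  ... | no _     | yes refl = trans y∉A (sym (swapElem-old B (x≢y ∘ sym)))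
  ... | no n≢x   | no n≢y   = trans (sym (unchanged n≢x n≢y)) (sym (swapElem-other B n≢y n≢x))

  isNumericalSemigroup : IsNumericalSemigroup A → IsMinimalGenerator A x →
                         IsPseudoFrobenius (remove A x) y → y + y ∈ remove A x →
                         IsNumericalSemigroup B
  isNumericalSemigroup nsA (_ , 0<x , indecomposable) (_ , y+) y+y∈ = record
    { has-zero = remove⊆ (∈-remove⁺ A has-zero (<⇒≢ 0<x))
    ; closed   = closedB
    ; cofinite = N + suc x , λ n N+x<n →
        remove⊆ (∈-remove⁺ A (above n (m+n≤o⇒m≤o N N+x<n)) (>⇒≢ (m+n≤o⇒n≤o N N+x<n)))
    }
    where
    open IsNumericalSemigroup nsA
    N : ℕ
    N = proj₁ cofinite
    above : ∀ n → N ≤ n → n ∈ A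
    above = proj₂ cofinite

    y+-∈ : ∀ {b} → b ∈ B → b ≢ y → y + b ∈ B
    y+-∈ {zero}  _   _   = subst (_∈ B) (sym (+-identityʳ y)) swapped-in
    y+-∈ {suc b} b∈B b≢y = remove⊆ (y+ (suc b) (⊆remove b∈B b≢y) z<s)

    +-∈ : ∀ {a b} → a ∈ remove A x → b ∈ remove A x → a + b ∈ B
    +-∈ {zero}          _  b∈ = remove⊆ b∈
    +-∈ {a}     {zero}  a∈ _  = subst (_∈ B) (sym (+-identityʳ a)) (remove⊆ a∈)
    +-∈ {suc a} {suc b} a∈ b∈ = remove⊆ (∈-remove⁺ A (closed _ _ a∈A b∈A) a+b≢x)
      where
      a∈A : suc a ∈ A
      a∈A = proj₁ (∈-remove⁻ A x a∈)
      b∈A : suc b ∈ A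
      b∈A = proj₁ (∈-remove⁻ A x b∈)
      a+b≢x : suc a + suc b ≢ x
      a+b≢x a+b≡x = indecomposable (suc a , suc b , a∈A , b∈A , z<s , z<s , a+b≡x)

    closedB : ∀ a b → a ∈ B → b ∈ B → a + b ∈ B
    closedB a b a∈ b∈ with a ≟ y | b ≟ y
    ... | yes refl | yes refl = remove⊆ y+y∈
    ... | yes refl | no b≢y   = y+-∈ b∈ b≢y
    ... | no a≢y   | yes refl = subst (_∈ B) (+-comm y a) (y+-∈ a∈ a≢y)
    ... | no a≢y   | no b≢y   = +-∈ (⊆remove a∈ a≢y) (⊆remove b∈ b≢y)

  isFrobenius : ∀ {F} → x < F → y < F → IsFrobenius A F → IsFrobenius B F
  isFrobenius x<F y<F (F∉A , above) =
    trans (unchanged (>⇒≢ x<F) (>⇒≢ y<F)) F∉A ,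
    λ n F<n → trans (unchanged (>⇒≢ (<-trans x<F F<n)) (>⇒≢ (<-trans y<F F<n))) (above n F<n)

  -- The indicators of x and y are added on both sides so that no subtraction occurs.
  countGaps-+ : x ∈ A → y ∉ A → ∀ N →
    countGaps A N + occurrencesBelow x N ≡ countGaps B N + occurrencesBelow y N
  countGaps-+ x∈A y∉A zero    = refl
  countGaps-+ x∈A y∉A (suc n) = trans (interchange gapA (countGaps A n) hitX (occurrencesBelow x n))
    (trans (cong₂ _+_ step (countGaps-+ x∈A y∉A n))
           (interchange gapB hitY (countGaps B n) (occurrencesBelow y n)))
    where
    gapA gapB hitX hitY : ℕ
    gapA = if A n then 0 else 1
    gapB = if B n then 0 else 1
    hitX = if n ≡ᵇ x then 1 else 0
    hitY = if n ≡ᵇ y then 1 else 0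
    step : gapA + hitX ≡ gapB + hitY
    step with n ≟ x | n ≟ y
    ... | yes refl | _        rewrite x∈A | swapped-out | ≡ᵇ-refl n | ≢⇒≡ᵇ≡false x≢y = refl
    ... | no n≢x   | yes refl rewrite y∉A | swapped-in | ≡ᵇ-refl n | ≢⇒≡ᵇ≡false n≢x = refl
    ... | no n≢x   | no n≢y
      rewrite unchanged n≢x n≢y | ≢⇒≡ᵇ≡false n≢x | ≢⇒≡ᵇ≡false n≢y = refl

  isGenus : ∀ {F g} → x ∈ A → y ∉ A → x < F → y < F →
            IsFrobenius A F → IsGenus A g → IsGenus B g
  isGenus {F} x∈A y∉A x<F y<F frA (N , above , gaps) =
    N , (λ n N≤n → proj₂ (isFrobenius x<F y<F frA) n (<-≤-trans F<N N≤n)) ,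
    trans (sym gapsA≡gapsB) gaps
    where
    F<N : F < N
    F<N = ≰⇒> (λ N≤F → ∉⇒¬∈ A (proj₁ frA) (above F N≤F))
    gapsA≡gapsB : countGaps A N ≡ countGaps B N
    gapsA≡gapsB = +-cancelʳ-≡ 1 _ _ (begin
      countGaps A N + 1                     ≡⟨ cong (countGaps A N +_) (occurrencesBelow-> (<-trans x<F F<N)) ⟨
      countGaps A N + occurrencesBelow x N  ≡⟨ countGaps-+ x∈A y∉A N ⟩
      countGaps B N + occurrencesBelow y N  ≡⟨ cong (countGaps B N +_) (occurrencesBelow-> (<-trans y<F F<N)) ⟩
      countGaps B N + 1                     ∎)
      where open ≡-Reasoning

  θ-≐ : ∀ {F} → 0 < y → y + x ≡ F → y < x → x ∈ A → y ∉ A → θ F B ≐ θ F A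
  θ-≐ {F} 0<y y+x≡F y<x x∈A y∉A = pointwise
    where
    F∸x≡y : F ∸ x ≡ y
    F∸x≡y = trans (cong (_∸ x) (sym y+x≡F)) (m+n∸n≡m y x)
    F∸y≡x : F ∸ y ≡ x
    F∸y≡x = trans (cong (_∸ y) (sym y+x≡F)) (m+n∸m≡n y x)
    x-not-small : isSmall F x ≡ false
    x-not-small = isSmall-false {F} {x} (subst₂ _≤_ y+x≡F (sym (2*n≡n+n x)) (+-monoˡ-≤ x (<⇒≤ y<x)))
    y-small : isSmall F y ≡ true
    y-small = isSmall-true 0<y (subst₂ _<_ (sym (2*n≡n+n y)) y+x≡F (+-monoʳ-< y y<x))
    x≤ᵇF : (x ≤ᵇ F) ≡ true
    x≤ᵇF = Equivalence.to T-≡ (≤⇒≤ᵇ (subst (x ≤_) y+x≡F (m≤n+m x y)))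
    y≤ᵇF : (y ≤ᵇ F) ≡ true
    y≤ᵇF = Equivalence.to T-≡ (≤⇒≤ᵇ (subst (y ≤_) y+x≡F (m≤m+n y x)))

    F∸n≢x : ∀ {n} → n ≢ y → F ∸ n ≢ x
    F∸n≢x n≢y F∸n≡x = n≢y (trans (m∸n≡o⇒n≡m∸o (<-trans 0<y y<x) F∸n≡x) F∸x≡y)
    F∸n≢y : ∀ {n} → n ≢ x → F ∸ n ≢ y
    F∸n≢y n≢x F∸n≡y = n≢x (trans (m∸n≡o⇒n≡m∸o 0<y F∸n≡y) F∸y≡x)

    pointwise : θ F B ≐ θ F A
    pointwise n with n ≟ x | n ≟ y
    ... | yes refl | _
      rewrite F∸x≡y | swapped-out | swapped-in | x∈A | x-not-small | y-small | x≤ᵇF = refl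
    ... | no _ | yes refl
      rewrite F∸y≡x | swapped-in | swapped-out | y∉A | x-not-small | y-small | y≤ᵇF = refl
    ... | no n≢x | no n≢y
      rewrite unchanged n≢x n≢y | unchanged (F∸n≢x n≢y) (F∸n≢y n≢x) = refl

SwapCriterion : ℕ → Subset → Subset → ℕ → ℕ → Set
SwapCriterion F Q P x y =
  IsMinimalGenerator Q x × F < 2 * x × x < F ×
  (∀ m → IsMultiplicity Q m → y < m) ×
  2 * F ≢ 3 * x ×
  IsMinimalGenerator Q (2 * y) ×
  IsPseudoFrobenius (remove Q x) y ×
  (P ≐ swapElem Q x y)

module ChildToCriterion
  {P Q : Subset} {F m : ℕ} (nsP : IsNumericalSemigroup P) (F∉P : F ∉ P)
  (m-multiplicity : IsMultiplicity P m) (2m<F : 2 * m < F)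
  (Q≐ : Q ≐ swapElem P m (F ∸ m)) where

  open IsNumericalSemigroup nsP

  x : ℕ
  x = F ∸ m

  0<m : 0 < m
  0<m = proj₁ m-multiplicity
  m∈P : m ∈ P
  m∈P = proj₁ (proj₂ m-multiplicity)
  ∉-below-m : ∀ k → 0 < k → k < m → k ∉ P
  ∉-below-m = proj₂ (proj₂ m-multiplicity)

  m≤F : m ≤ F
  m≤F = ≤-trans (m≤m+n m (m + 0)) (<⇒≤ 2m<F)

  m+x≡F : m + x ≡ F
  m+x≡F = m+[n∸m]≡n m≤F

  m<x : m < x
  m<x = +-cancelˡ-< m m x (subst₂ _<_ (2*n≡n+n m) (sym m+x≡F) 2m<F)

  ∈P⇒≢F : ∀ {n} → n ∈ P → n ≢ F
  ∈P⇒≢F n∈P refl = ∉⇒¬∈ P F∉P n∈P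

  open SwapElem Q≐ (<⇒≢ m<x)

  x∉P : x ∉ P
  x∉P with P x in x∈P
  ... | true  = contradiction m+x≡F (∈P⇒≢F (closed m x m∈P x∈P))
  ... | false = refl

  ∈Q⇒∈P : ∀ {n} → n ∈ Q → n ≢ x → n ∈ P
  ∈Q⇒∈P {n} n∈Q n≢x = trans (sym (unchanged n≢m n≢x)) n∈Q
    where
    n≢m : n ≢ m
    n≢m refl = ∉⇒¬∈ Q swapped-out n∈Q

  m<∈Q : ∀ {n} → 0 < n → n ∈ Q → m < n
  m<∈Q {n} 0<n n∈Q with n ≟ x
  ... | yes refl = m<x
  ... | no n≢x   = ≤∧≢⇒< (≮⇒≥ n≮m) m≢n
    where
    n∈P : n ∈ P
    n∈P = ∈Q⇒∈P n∈Q n≢x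
    n≮m : ¬ n < m
    n≮m n<m = ∉⇒¬∈ P (∉-below-m n 0<n n<m) n∈P
    m≢n : m ≢ n
    m≢n refl = ∉⇒¬∈ Q swapped-out n∈Q

  x-minimalGenerator : IsMinimalGenerator Q x
  x-minimalGenerator = swapped-in , <-trans 0<m m<x ,
    λ { (a , b , a∈Q , b∈Q , 0<a , 0<b , a+b≡x) →
      let a∈P = ∈Q⇒∈P a∈Q (<⇒≢ (subst (a <_) a+b≡x (m<m+n a 0<b)))
          b∈P = ∈Q⇒∈P b∈Q (<⇒≢ (subst (b <_) a+b≡x (m<n+m b 0<a)))
      in ∈P⇒≢F (closed a (m + b) a∈P (closed m b m∈P b∈P))
               (trans (x∙yz≈y∙xz a m b) (trans (cong (m +_) a+b≡x) m+x≡F)) }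

  F<2x : F < 2 * x
  F<2x = subst₂ _<_ m+x≡F (sym (2*n≡n+n x)) (+-monoˡ-< x m<x)

  x<F : x < F
  x<F = subst (x <_) m+x≡F (m<n+m x 0<m)

  2F≢3x : 2 * F ≢ 3 * x
  2F≢3x 2F≡3x = ∈P⇒≢F (closed m (m + m) m∈P (closed m m m∈P m∈P))
    (trans (cong (m +_) (Equivalence.from (double≡⇔2*sum≡3* m+x≡F) 2F≡3x)) m+x≡F)

  2m-minimalGenerator : IsMinimalGenerator Q (2 * m)
  2m-minimalGenerator = subst (IsMinimalGenerator Q) (sym (2*n≡n+n m))
    ( trans (unchanged (>⇒≢ (m<m+n m 0<m)) m+m≢x) m+m∈P
    , <-≤-trans 0<m (m≤m+n m m)
    , λ { (a , b , a∈Q , b∈Q , 0<a , 0<b , a+b≡m+m) →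
          <-irrefl (sym a+b≡m+m) (+-mono-< (m<∈Q 0<a a∈Q) (m<∈Q 0<b b∈Q)) } )
    where
    m+m∈P : m + m ∈ P
    m+m∈P = closed m m m∈P m∈P
    m+m≢x : m + m ≢ x
    m+m≢x m+m≡x = ∉⇒¬∈ P x∉P (subst (_∈ P) m+m≡x m+m∈P)

  m-pseudoFrobenius : IsPseudoFrobenius (remove Q x) m
  m-pseudoFrobenius = trans (remove-other Q (<⇒≢ m<x)) swapped-out , m+-∈
    where
    m+-∈ : ∀ s → s ∈ remove Q x → 0 < s → m + s ∈ remove Q x
    m+-∈ s s∈ 0<s = ∈-remove⁺ Q (trans (unchanged (>⇒≢ (m<m+n m 0<s)) m+s≢x) m+s∈P) m+s≢x
      where
      s∈P : s ∈ P
      s∈P = ∈Q⇒∈P (proj₁ (∈-remove⁻ Q x s∈)) (proj₂ (∈-remove⁻ Q x s∈))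
      m+s∈P : m + s ∈ P
      m+s∈P = closed m s m∈P s∈P
      m+s≢x : m + s ≢ x
      m+s≢x m+s≡x = ∈P⇒≢F (closed m (m + s) m∈P m+s∈P) (trans (cong (m +_) m+s≡x) m+x≡F)

  criterion : ∃[ x ] SwapCriterion F Q P x (F ∸ x)
  criterion = x , subst (SwapCriterion F Q P x) (sym (m∸[m∸n]≡n m≤F))
    ( x-minimalGenerator , F<2x , x<F
    , (λ m′ (0<m′ , m′∈Q , _) → m<∈Q 0<m′ m′∈Q)
    , 2F≢3x , 2m-minimalGenerator , m-pseudoFrobenius , inverse m∈P x∉P )

module CriterionToChild
  {F g : ℕ} {S Q P : Subset} {x : ℕ} (Q∈[S] : InClass F g S Q)
  (x-minimalGenerator : IsMinimalGenerator Q x) (F<2x : F < 2 * x) (x<F : x < F)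
  (y<multiplicity : ∀ m → IsMultiplicity Q m → F ∸ x < m) (2F≢3x : 2 * F ≢ 3 * x)
  (2y-minimalGenerator : IsMinimalGenerator Q (2 * (F ∸ x)))
  (y-pseudoFrobenius : IsPseudoFrobenius (remove Q x) (F ∸ x))
  (P≐ : P ≐ swapElem Q x (F ∸ x)) where

  y : ℕ
  y = F ∸ x

  nsQ : IsNumericalSemigroup Q
  nsQ = proj₁ (proj₁ Q∈[S])
  frQ : IsFrobenius Q F
  frQ = proj₁ (proj₂ (proj₁ Q∈[S]))
  genusQ : IsGenus Q g
  genusQ = proj₂ (proj₂ (proj₁ Q∈[S]))
  x∈Q : x ∈ Q
  x∈Q = proj₁ x-minimalGenerator

  y+x≡F : y + x ≡ F
  y+x≡F = m∸n+n≡m (<⇒≤ x<F)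

  y<x : y < x
  y<x = +-cancelʳ-< x y x (subst₂ _<_ (sym y+x≡F) (2*n≡n+n x) F<2x)

  0<y : 0 < y
  0<y = n≢0⇒n>0 (m>n⇒m∸n≢0 x<F)

  y<F : y < F
  y<F = <-trans y<x x<F

  ∉Q-up-to-y : ∀ k → 0 < k → k ≤ y → k ∉ Q
  ∉Q-up-to-y = ∉-below-multiplicity Q y<multiplicity

  y∉Q : y ∉ Q
  y∉Q = ∉Q-up-to-y y 0<y ≤-refl

  y+y∈Q∖x : y + y ∈ remove Q x
  y+y∈Q∖x = ∈-remove⁺ Q (subst (_∈ Q) (2*n≡n+n y) (proj₁ 2y-minimalGenerator))
    (2F≢3x ∘ Equivalence.to (double≡⇔2*sum≡3* y+x≡F))

  open SwapElem P≐ (>⇒≢ y<x)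

  y-multiplicity : IsMultiplicity P y
  y-multiplicity = 0<y , swapped-in , λ k 0<k k<y →
    trans (unchanged (<⇒≢ (<-trans k<y y<x)) (<⇒≢ k<y)) (∉Q-up-to-y k 0<k (<⇒≤ k<y))

  P∈[S] : InClass F g S P
  P∈[S] =
    ( isNumericalSemigroup nsQ x-minimalGenerator y-pseudoFrobenius y+y∈Q∖x
    , isFrobenius x<F y<F frQ
    , isGenus x∈Q y∉Q x<F y<F frQ genusQ )
    , λ n → trans (θ-≐ 0<y y+x≡F y<x x∈Q y∉Q n) (proj₂ Q∈[S] n)

  isChild : IsChild F g S P Q
  isChild = P∈[S] , Q∈[S] , y , y-multiplicity ,
    subst₂ _<_ (sym (2*n≡n+n y)) y+x≡F (+-monoʳ-< y y<x) ,
    subst (λ z → Q ≐ swapElem P y z) (sym (m∸[m∸n]≡n (<⇒≤ x<F))) (inverse x∈Q y∉Q)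

proposition11 : (F g : ℕ) → 0 < F → 0 < g → (S Q : Subset) →
    InEFg F g S → InClass F g S Q → (P : Subset) →
    IsChild F g S P Q ⇔
      (∃[ x ] (IsMinimalGenerator Q x × F < 2 * x × x < F ×
               (∀ m → IsMultiplicity Q m → F ∸ x < m) ×
               2 * F ≢ 3 * x ×
               IsMinimalGenerator Q (2 * (F ∸ x)) ×
               IsPseudoFrobenius (remove Q x) (F ∸ x) ×
               (P ≐ swapElem Q x (F ∸ x))))
proposition11 F g _ _ S Q _ Q∈[S] P = mk⇔ toCriterion fromCriterion
  where
  toCriterion : IsChild F g S P Q → ∃[ x ] SwapCriterion F Q P x (F ∸ x)
  toCriterion (((nsP , (F∉P , _) , _) , _) , _ , m , m-multiplicity , 2m<F , Q≐) =
    ChildToCriterion.criterion nsP F∉P m-multiplicity 2m<F Q≐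

  fromCriterion : ∃[ x ] SwapCriterion F Q P x (F ∸ x) → IsChild F g S P Q
  fromCriterion (x , x-min , F<2x , x<F , y<mult , 2F≢3x , 2y-min , y-pf , P≐) =
    CriterionToChild.isChild Q∈[S] x-min F<2x x<F y<mult 2F≢3x 2y-min y-pf P≐
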